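{- Let $\mathcal C$ be a coherent category with a parametrised natural number object $(N,\mathsf 0,\mathsf s)$. Let $X$ be an object, $\varphi$ a subobject of $X$ and $\psi$ a subobject of $X\times N$. If $X\models\psi(x,\mathsf 0)\vdash\varphi(x)$ and $X\times N\models\psi(x,\mathsf sn)\vdash\varphi(x)\vee\psi(x,n)$, then $X\times N\models\psi(x,n)\vdash\varphi(x)$.
   Context: A coherent category has finite limits, pullback-stable image factorisations and pullback-stable finite unions of subobjects. A parametrised natural number object (PNO) is an object $N$ with $\mathsf 0:1\to N$, $\mathsf s:N\to N$ such that for all $f:A\to X$, $g:X\to X$ there is a unique $r:A\times N\to X$ with $r\circ\langle\mathrm{id},\mathsf 0\rangle=f$ and $r\circ(\mathrm{id}\times\mathsf s)=g\circ r$. Notation of the internal logic: for subobjects $\alpha,\beta$ of an object $Y$, $Y\models\alpha\vdash\beta$ means $\alpha\le\beta$ in $\mathrm{Sub}(Y)$; $\psi(x,\mathsf 0)$, $\psi(x,\mathsf sn)$ denote pullbacks of $\psi$ along $\langle\mathrm{id},\mathsf 0\rangle$ resp. $\mathrm{id}\times\mathsf s$, $\varphi(x)$ in context $X\times N$ is the pullback along the projection; $\vee$ is the join of subobjects. -}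

module Defs where

-- Categories have hom-setoids; a coherent category is presented via chosen
-- finite limits (terminal object, binary products, pullbacks), chosen image
-- factorisations and chosen finite unions in Sub(Y), all pullback-stable.

open import Level using (Level; _⊔_; suc)
open import Data.Product using (Σ; _,_; _×_; proj₁; proj₂; ∃)
open import Relation.Binary using (IsEquivalence; Setoid)
import Relation.Binary.Reasoning.Setoid as SetoidR

record Category (o ℓ e : Level) : Set (suc (o ⊔ ℓ ⊔ e)) where
  infixr 9 _∘_
  infix  4 _≈_
  infix  5 _⇒_
  field
    Obj   : Set o
    _⇒_   : Obj → Obj → Set ℓ
    _≈_   : ∀ {A B} → A ⇒ B → A ⇒ B → Set e
    ≈-equiv : ∀ {A B} → IsEquivalence (_≈_ {A} {B})
    id    : ∀ {A} → A ⇒ A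
    _∘_   : ∀ {A B C} → B ⇒ C → A ⇒ B → A ⇒ C
    assoc : ∀ {A B C D} {f : A ⇒ B} {g : B ⇒ C} {h : C ⇒ D} →
            (h ∘ g) ∘ f ≈ h ∘ (g ∘ f)
    identityˡ : ∀ {A B} {f : A ⇒ B} → id ∘ f ≈ f
    identityʳ : ∀ {A B} {f : A ⇒ B} → f ∘ id ≈ f
    ∘-resp-≈ : ∀ {A B C} {f h : B ⇒ C} {g i : A ⇒ B} →
               f ≈ h → g ≈ i → f ∘ g ≈ h ∘ i

  hom-setoid : ∀ {A B} → Setoid ℓ e
  hom-setoid {A} {B} = record { Carrier = A ⇒ B ; _≈_ = _≈_ ; isEquivalence = ≈-equiv }

  module Equiv {A B : Obj} = IsEquivalence (≈-equiv {A} {B})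

module _ {o ℓ e} (C : Category o ℓ e) where
  open Category C

  Mono : ∀ {A B} → A ⇒ B → Set (o ⊔ ℓ ⊔ e)
  Mono {A} f = ∀ {Z} (g h : Z ⇒ A) → f ∘ g ≈ f ∘ h → g ≈ h

  record Terminal : Set (o ⊔ ℓ ⊔ e) where
    field
      ⊤  : Obj
      !  : ∀ {A} → A ⇒ ⊤
      !-unique : ∀ {A} (f : A ⇒ ⊤) → f ≈ !

  record Product (A B : Obj) : Set (o ⊔ ℓ ⊔ e) where
    field
      A×B : Obj
      π₁  : A×B ⇒ A
      π₂  : A×B ⇒ B
      ⟨_,_⟩ : ∀ {Z} → Z ⇒ A → Z ⇒ B → Z ⇒ A×B
      project₁ : ∀ {Z} {f : Z ⇒ A} {g : Z ⇒ B} → π₁ ∘ ⟨ f , g ⟩ ≈ f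
      project₂ : ∀ {Z} {f : Z ⇒ A} {g : Z ⇒ B} → π₂ ∘ ⟨ f , g ⟩ ≈ g
      unique   : ∀ {Z} {f : Z ⇒ A} {g : Z ⇒ B} (h : Z ⇒ A×B) →
                 π₁ ∘ h ≈ f → π₂ ∘ h ≈ g → h ≈ ⟨ f , g ⟩

  record Pullback {A B Y : Obj} (f : A ⇒ Y) (g : B ⇒ Y) : Set (o ⊔ ℓ ⊔ e) where
    field
      P  : Obj
      p₁ : P ⇒ A
      p₂ : P ⇒ B
      commute : f ∘ p₁ ≈ g ∘ p₂
      universal : ∀ {Z} (h₁ : Z ⇒ A) (h₂ : Z ⇒ B) → f ∘ h₁ ≈ g ∘ h₂ → Z ⇒ P
      p₁∘universal : ∀ {Z} {h₁ : Z ⇒ A} {h₂ : Z ⇒ B} {eq : f ∘ h₁ ≈ g ∘ h₂} →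
                     p₁ ∘ universal h₁ h₂ eq ≈ h₁
      p₂∘universal : ∀ {Z} {h₁ : Z ⇒ A} {h₂ : Z ⇒ B} {eq : f ∘ h₁ ≈ g ∘ h₂} →
                     p₂ ∘ universal h₁ h₂ eq ≈ h₂
      unique : ∀ {Z} (u v : Z ⇒ P) → p₁ ∘ u ≈ p₁ ∘ v → p₂ ∘ u ≈ p₂ ∘ v → u ≈ v

  record Sub (Y : Obj) : Set (o ⊔ ℓ ⊔ e) where
    field
      dom  : Obj
      arr  : dom ⇒ Y
      mono : Mono arr

  infix 4 _≤ₛ_ _≅ₛ_
  _≤ₛ_ : ∀ {Y} → Sub Y → Sub Y → Set (ℓ ⊔ e)
  α ≤ₛ β = Σ (Sub.dom α ⇒ Sub.dom β) λ h → Sub.arr β ∘ h ≈ Sub.arr α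

  _≅ₛ_ : ∀ {Y} → Sub Y → Sub Y → Set (ℓ ⊔ e)
  α ≅ₛ β = (α ≤ₛ β) × (β ≤ₛ α)

  pullback-mono : ∀ {A B Y} {f : A ⇒ Y} {m : B ⇒ Y} (pb : Pullback f m) →
                  Mono m → Mono (Pullback.p₁ pb)
  pullback-mono {f = f} {m} pb mono-m g h eq =
    unique g h eq (mono-m (p₂ ∘ g) (p₂ ∘ h) step)
    where
      open Pullback pb
      open SetoidR hom-setoid
      step : m ∘ (p₂ ∘ g) ≈ m ∘ (p₂ ∘ h)
      step = begin
        m ∘ (p₂ ∘ g)  ≈⟨ Equiv.sym assoc ⟩
        (m ∘ p₂) ∘ g  ≈⟨ ∘-resp-≈ (Equiv.sym commute) Equiv.refl ⟩
        (f ∘ p₁) ∘ g  ≈⟨ assoc ⟩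
        f ∘ (p₁ ∘ g)  ≈⟨ ∘-resp-≈ Equiv.refl eq ⟩
        f ∘ (p₁ ∘ h)  ≈⟨ Equiv.sym assoc ⟩
        (f ∘ p₁) ∘ h  ≈⟨ ∘-resp-≈ commute Equiv.refl ⟩
        (m ∘ p₂) ∘ h  ≈⟨ assoc ⟩
        m ∘ (p₂ ∘ h)  ∎

record FinitelyComplete {o ℓ e} (C : Category o ℓ e) : Set (o ⊔ ℓ ⊔ e) where
  open Category C
  field
    terminal : Terminal C
    product  : ∀ (A B : Obj) → Product C A B
    pullback : ∀ {A B Y : Obj} (f : A ⇒ Y) (g : B ⇒ Y) → Pullback C f g

  open Terminal terminal public

  infixr 7 _×₀_
  _×₀_ : Obj → Obj → Obj
  A ×₀ B = Product.A×B (product A B)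

  π₁ : ∀ {A B} → A ×₀ B ⇒ A
  π₁ {A} {B} = Product.π₁ (product A B)

  π₂ : ∀ {A B} → A ×₀ B ⇒ B
  π₂ {A} {B} = Product.π₂ (product A B)

  ⟨_,_⟩ : ∀ {Z A B} → Z ⇒ A → Z ⇒ B → Z ⇒ A ×₀ B
  ⟨_,_⟩ {Z} {A} {B} f g = Product.⟨_,_⟩ (product A B) f g

  infixr 8 _⁂_
  _⁂_ : ∀ {A B A' B'} → A ⇒ A' → B ⇒ B' → A ×₀ B ⇒ A' ×₀ B'
  f ⁂ g = ⟨ f ∘ π₁ , g ∘ π₂ ⟩

  infixr 9 _*_
  _*_ : ∀ {Z Y} → Z ⇒ Y → Sub C Y → Sub C Z
  f * α = record
    { dom  = Pullback.P (pullback f (Sub.arr α))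
    ; arr  = Pullback.p₁ (pullback f (Sub.arr α))
    ; mono = pullback-mono C (pullback f (Sub.arr α)) (Sub.mono α)
    }

record Coherent {o ℓ e} (C : Category o ℓ e) : Set (o ⊔ ℓ ⊔ e) where
  open Category C
  field
    finitelyComplete : FinitelyComplete C
  open FinitelyComplete finitelyComplete public
  infixr 6 _∨_
  field
    image        : ∀ {A Y} → A ⇒ Y → Sub C Y
    image-factor : ∀ {A Y} (f : A ⇒ Y) →
                   Σ (A ⇒ Sub.dom (image f)) λ q → Sub.arr (image f) ∘ q ≈ f
    image-least  : ∀ {A Y} (f : A ⇒ Y) (m : Sub C Y) →
                   (Σ (A ⇒ Sub.dom m) λ q → Sub.arr m ∘ q ≈ f) →
                   _≤ₛ_ C (image f) m
    image-stable : ∀ {A Y Z} (g : A ⇒ Y) (f : Z ⇒ Y) →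
                   _≅ₛ_ C (image (Pullback.p₁ (pullback f g))) (f * image g)
    ⊥ₛ       : ∀ {Y} → Sub C Y
    ⊥ₛ-least : ∀ {Y} (α : Sub C Y) → _≤ₛ_ C ⊥ₛ α
    _∨_      : ∀ {Y} → Sub C Y → Sub C Y → Sub C Y
    ∨-inl    : ∀ {Y} (α β : Sub C Y) → _≤ₛ_ C α (α ∨ β)
    ∨-inr    : ∀ {Y} (α β : Sub C Y) → _≤ₛ_ C β (α ∨ β)
    ∨-least  : ∀ {Y} (α β γ : Sub C Y) → _≤ₛ_ C α γ → _≤ₛ_ C β γ → _≤ₛ_ C (α ∨ β) γ
    ⊥ₛ-stable : ∀ {Z Y} (f : Z ⇒ Y) → _≤ₛ_ C (f * ⊥ₛ) ⊥ₛ
    ∨-stable  : ∀ {Z Y} (f : Z ⇒ Y) (α β : Sub C Y) →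
                _≤ₛ_ C (f * (α ∨ β)) (f * α ∨ f * β)

record PNO {o ℓ e} {C : Category o ℓ e} (L : FinitelyComplete C) : Set (o ⊔ ℓ ⊔ e) where
  open Category C
  open FinitelyComplete L
  field
    N : Obj
    z : ⊤ ⇒ N
    s : N ⇒ N
    rec : ∀ {A X} (f : A ⇒ X) (g : X ⇒ X) → A ×₀ N ⇒ X
    rec-zero : ∀ {A X} (f : A ⇒ X) (g : X ⇒ X) → rec f g ∘ ⟨ id , z ∘ ! ⟩ ≈ f
    rec-succ : ∀ {A X} (f : A ⇒ X) (g : X ⇒ X) → rec f g ∘ (id ⁂ s) ≈ g ∘ rec f g
    rec-unique : ∀ {A X} (f : A ⇒ X) (g : X ⇒ X) (r : A ×₀ N ⇒ X) →
                 r ∘ ⟨ id , z ∘ ! ⟩ ≈ f → r ∘ (id ⁂ s) ≈ g ∘ r → r ≈ rec f g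

{-# OPTIONS --safe #-}
-- Put U(x, n) = φ(x) ∨ ψ(x, n) and let d(x, n) = (x, n − 1). Since every n is 0 or a
-- successor, the step hypothesis makes U closed under d. Coherent logic has no ∀, so
-- instead of an induction on n we iterate d with the recursor, rec f d (a, k) = dᵏ (f a):
-- for (x, n) in ψ all iterates dᵏ (x, n) lie in U, the n-th one is (x, 0), and
-- U(x, 0) ⊢ φ(x) by the base hypothesis.
module Submission where

open import Level using (_⊔_)
open import Data.Product using (_×_; _,_; proj₁; proj₂)
import Relation.Binary.Reasoning.Setoid as SetoidReasoning
open import Defs

module HomReasoning {o ℓ e} (C : Category o ℓ e) where
  open Category C
  open Equiv public

  private
    module Reasoning {A B : Obj} = SetoidReasoning (hom-setoid {A} {B})
  open Reasoning public

  ∘-resp-≈ˡ : ∀ {A B D} {f h : B ⇒ D} {g : A ⇒ B} → f ≈ h → f ∘ g ≈ h ∘ g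
  ∘-resp-≈ˡ p = ∘-resp-≈ p refl

  ∘-resp-≈ʳ : ∀ {A B D} {f : B ⇒ D} {g i : A ⇒ B} → g ≈ i → f ∘ g ≈ f ∘ i
  ∘-resp-≈ʳ p = ∘-resp-≈ refl p

  pullˡ : ∀ {A B D E} {f : D ⇒ E} {g : B ⇒ D} {h : B ⇒ E} {i : A ⇒ B} →
          f ∘ g ≈ h → f ∘ (g ∘ i) ≈ h ∘ i
  pullˡ p = trans (sym assoc) (∘-resp-≈ˡ p)

  pullʳ : ∀ {A B D E} {f : D ⇒ E} {g : B ⇒ D} {i : A ⇒ B} {h : A ⇒ D} →
          g ∘ i ≈ h → (f ∘ g) ∘ i ≈ f ∘ h
  pullʳ p = trans assoc (∘-resp-≈ʳ p)

  id-comm : ∀ {A B} {f : A ⇒ B} → f ∘ id ≈ id ∘ f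
  id-comm = trans identityʳ (sym identityˡ)

  id-comm-sym : ∀ {A B} {f : A ⇒ B} → id ∘ f ≈ f ∘ id
  id-comm-sym = sym id-comm

module ProductLaws {o ℓ e} {C : Category o ℓ e} (L : FinitelyComplete C) where
  open Category C
  open FinitelyComplete L
  open HomReasoning C

  project₁ : ∀ {Z A B} {f : Z ⇒ A} {g : Z ⇒ B} → π₁ ∘ ⟨ f , g ⟩ ≈ f
  project₁ {A = A} {B} = Product.project₁ (product A B)

  project₂ : ∀ {Z A B} {f : Z ⇒ A} {g : Z ⇒ B} → π₂ ∘ ⟨ f , g ⟩ ≈ g
  project₂ {A = A} {B} = Product.project₂ (product A B)

  ⟨⟩-unique : ∀ {Z A B} {f : Z ⇒ A} {g : Z ⇒ B} (h : Z ⇒ A ×₀ B) →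
              π₁ ∘ h ≈ f → π₂ ∘ h ≈ g → h ≈ ⟨ f , g ⟩
  ⟨⟩-unique {A = A} {B} = Product.unique (product A B)

  ⟨⟩-cong₂ : ∀ {Z A B} {f f′ : Z ⇒ A} {g g′ : Z ⇒ B} →
             f ≈ f′ → g ≈ g′ → ⟨ f , g ⟩ ≈ ⟨ f′ , g′ ⟩
  ⟨⟩-cong₂ p q = ⟨⟩-unique _ (trans project₁ p) (trans project₂ q)

  ⟨π₁,π₂⟩≈id : ∀ {A B} → ⟨ π₁ , π₂ ⟩ ≈ id {A ×₀ B}
  ⟨π₁,π₂⟩≈id = sym (⟨⟩-unique id identityʳ identityʳ)

  ⟨⟩∘ : ∀ {W Z A B} {f : Z ⇒ A} {g : Z ⇒ B} {h : W ⇒ Z} →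
        ⟨ f , g ⟩ ∘ h ≈ ⟨ f ∘ h , g ∘ h ⟩
  ⟨⟩∘ = ⟨⟩-unique _ (pullˡ project₁) (pullˡ project₂)

  ⁂∘⟨⟩ : ∀ {Z A B A′ B′} {f : A ⇒ A′} {g : B ⇒ B′} {h : Z ⇒ A} {k : Z ⇒ B} →
         (f ⁂ g) ∘ ⟨ h , k ⟩ ≈ ⟨ f ∘ h , g ∘ k ⟩
  ⁂∘⟨⟩ = trans ⟨⟩∘ (⟨⟩-cong₂ (pullʳ project₁) (pullʳ project₂))

  ⁂∘⁂ : ∀ {A B A′ B′ A″ B″} {f : A′ ⇒ A″} {g : B′ ⇒ B″} {h : A ⇒ A′} {k : B ⇒ B′} →
        (f ⁂ g) ∘ (h ⁂ k) ≈ (f ∘ h) ⁂ (g ∘ k)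
  ⁂∘⁂ = trans ⁂∘⟨⟩ (⟨⟩-cong₂ (sym assoc) (sym assoc))

  ⁂-cong₂ : ∀ {A B A′ B′} {f f′ : A ⇒ A′} {g g′ : B ⇒ B′} →
            f ≈ f′ → g ≈ g′ → f ⁂ g ≈ f′ ⁂ g′
  ⁂-cong₂ p q = ⟨⟩-cong₂ (∘-resp-≈ˡ p) (∘-resp-≈ˡ q)

  ⁂-interchange : ∀ {A B A′ B′} {f : A ⇒ A′} {g : B ⇒ B′} →
                  (f ⁂ id) ∘ (id ⁂ g) ≈ (id ⁂ g) ∘ (f ⁂ id)
  ⁂-interchange = begin
    (_ ⁂ id) ∘ (id ⁂ _)  ≈⟨ ⁂∘⁂ ⟩
    (_ ∘ id) ⁂ (id ∘ _)  ≈⟨ ⁂-cong₂ id-comm id-comm-sym ⟩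
    (id ∘ _) ⁂ (_ ∘ id)  ≈⟨ ⁂∘⁂ ⟨
    (id ⁂ _) ∘ (_ ⁂ id)  ∎

  !-absorbˡ : ∀ {A B D} {f : ⊤ ⇒ D} {h : A ⇒ B} → (f ∘ !) ∘ h ≈ f ∘ !
  !-absorbˡ = pullʳ (!-unique _)

module Membership {o ℓ e} {C : Category o ℓ e} (L : FinitelyComplete C) where
  open Category C
  open FinitelyComplete L
  open HomReasoning C

  infix 4 _≤_ _∈ₛ_

  _≤_ : ∀ {Y} → Sub C Y → Sub C Y → Set (ℓ ⊔ e)
  _≤_ = _≤ₛ_ C

  record _∈ₛ_ {Z Y} (f : Z ⇒ Y) (α : Sub C Y) : Set (ℓ ⊔ e) where
    constructor factor
    field
      witness  : Z ⇒ Sub.dom α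
      commutes : Sub.arr α ∘ witness ≈ f

  open _∈ₛ_ public

  ≤⇒∈ : ∀ {Y} {α β : Sub C Y} → α ≤ β → Sub.arr α ∈ₛ β
  ≤⇒∈ (h , p) = factor h p

  ∈⇒≤ : ∀ {Y} {α β : Sub C Y} → Sub.arr α ∈ₛ β → α ≤ β
  ∈⇒≤ (factor h p) = h , p

  arr-∈ : ∀ {Y} {α : Sub C Y} → Sub.arr α ∈ₛ α
  arr-∈ = factor id identityʳ

  ∈-resp-≈ : ∀ {Z Y} {f g : Z ⇒ Y} {α : Sub C Y} → f ≈ g → f ∈ₛ α → g ∈ₛ α
  ∈-resp-≈ p (factor h q) = factor h (trans q p)

  ∈-resp-≤ : ∀ {Z Y} {f : Z ⇒ Y} {α β : Sub C Y} → α ≤ β → f ∈ₛ α → f ∈ₛ β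
  ∈-resp-≤ (k , p) (factor h q) = factor (k ∘ h) (trans (pullˡ p) q)

  ∈-∘ : ∀ {W Z Y} {f : Z ⇒ Y} {α : Sub C Y} → f ∈ₛ α → (g : W ⇒ Z) → f ∘ g ∈ₛ α
  ∈-∘ (factor h p) g = factor (h ∘ g) (trans (sym assoc) (∘-resp-≈ˡ p))

  *-∈⁺ : ∀ {Z W Y} {f : Z ⇒ W} {g : W ⇒ Y} {α : Sub C Y} → g ∘ f ∈ₛ α → f ∈ₛ g * α
  *-∈⁺ {f = f} {g} {α} (factor h p) =
    factor (Pullback.universal pb f h (sym p)) (Pullback.p₁∘universal pb)
    where pb = pullback g (Sub.arr α)

  *-∈⁻ : ∀ {Z W Y} {f : Z ⇒ W} {g : W ⇒ Y} {α : Sub C Y} → f ∈ₛ g * α → g ∘ f ∈ₛ α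
  *-∈⁻ {g = g} {α} (factor h p) =
    factor (Pullback.p₂ pb ∘ h)
           (trans (pullˡ (sym (Pullback.commute pb))) (trans assoc (∘-resp-≈ʳ p)))
    where pb = pullback g (Sub.arr α)

  *-section-≤ : ∀ {Y Z} {f : Y ⇒ Z} {g : Z ⇒ Y} {α : Sub C Y} →
                g ∘ f ≈ id → f * (g * α) ≤ α
  *-section-≤ {f = f} {g} {α} g∘f≈id =
    ∈⇒≤ {α = f * (g * α)} {α}
        (∈-resp-≈ (trans (pullˡ g∘f≈id) identityˡ)
                  (*-∈⁻ {g = g} {α} (*-∈⁻ {g = f} {g * α} arr-∈)))

module Unions {o ℓ e} {C : Category o ℓ e} (K : Coherent C) where
  open Category C
  open Coherent K
  open HomReasoning C
  open Membership finitelyComplete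

  ∈-image : ∀ {A Y} (f : A ⇒ Y) → f ∈ₛ image f
  ∈-image f = factor (proj₁ (image-factor f)) (proj₂ (image-factor f))

  image-least-∈ : ∀ {A Y} {f : A ⇒ Y} {α : Sub C Y} → f ∈ₛ α → image f ≤ α
  image-least-∈ {f = f} {α} (factor h p) = image-least f α (h , p)

  *-∨-least : ∀ {Z Y} (f : Z ⇒ Y) {α β : Sub C Y} {γ : Sub C Z} →
              f * α ≤ γ → f * β ≤ γ → f * (α ∨ β) ≤ γ
  *-∨-least f {α} {β} {γ} p q =
    ∈⇒≤ {α = f * (α ∨ β)} {γ}
        (∈-resp-≤ (∨-least (f * α) (f * β) γ p q)
                  (≤⇒∈ {α = f * (α ∨ β)} {f * α ∨ f * β} (∨-stable f α β)))

  ∈-∨-elim : ∀ {Z Y} {f : Z ⇒ Y} {α β γ : Sub C Y} →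
             f ∈ₛ α ∨ β → f * α ≤ f * γ → f * β ≤ f * γ → f ∈ₛ γ
  ∈-∨-elim {f = f} {α} {β} {γ} f∈α∨β p q =
    ∈-resp-≈ identityʳ (*-∈⁻ (∈-resp-≤ (*-∨-least f {α} {β} {f * γ} p q)
                                        (*-∈⁺ (∈-resp-≈ (sym identityʳ) f∈α∨β))))

  *-image-≤ : ∀ {Z A Y} {f : Z ⇒ Y} {g : A ⇒ Y} {γ : Sub C Y} →
              f ∘ Pullback.p₁ (pullback f g) ∈ₛ γ → f * image g ≤ f * γ
  *-image-≤ {f = f} {g} {γ} p₁∈γ =
    ∈⇒≤ {α = f * image g} {f * γ}
        (∈-resp-≤ (image-least-∈ (*-∈⁺ p₁∈γ))
                  (≤⇒∈ {α = f * image g} {image (Pullback.p₁ (pullback f g))}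
                       (proj₂ (image-stable g f))))

module NaturalNumbers {o ℓ e} {C : Category o ℓ e} {L : FinitelyComplete C}
                      (NNO : PNO L) where
  open Category C
  open FinitelyComplete L
  open PNO NNO
  open HomReasoning C
  open ProductLaws L
  open Membership L

  IsRec : ∀ {A X} → A ⇒ X → X ⇒ X → A ×₀ N ⇒ X → Set e
  IsRec f g r = r ∘ ⟨ id , z ∘ ! ⟩ ≈ f × r ∘ (id ⁂ s) ≈ g ∘ r

  rec-IsRec : ∀ {A X} (f : A ⇒ X) (g : X ⇒ X) → IsRec f g (rec f g)
  rec-IsRec f g = rec-zero f g , rec-succ f g

  IsRec-unique : ∀ {A X} {f : A ⇒ X} {g : X ⇒ X} {r r′ : A ×₀ N ⇒ X} →
                 IsRec f g r → IsRec f g r′ → r ≈ r′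
  IsRec-unique {r = r} {r′} (r₀ , r₊) (r′₀ , r′₊) =
    trans (rec-unique _ _ r r₀ r₊) (sym (rec-unique _ _ r′ r′₀ r′₊))

  IsRec-∘⁂id : ∀ {A A′ X} {f : A ⇒ X} {g : X ⇒ X} {r : A ×₀ N ⇒ X} (h : A′ ⇒ A) →
               IsRec f g r → IsRec (f ∘ h) g (r ∘ (h ⁂ id))
  IsRec-∘⁂id {f = f} {g} {r} h (r₀ , r₊) = zero-case , succ-case
    where
      zero-case : (r ∘ (h ⁂ id)) ∘ ⟨ id , z ∘ ! ⟩ ≈ f ∘ h
      zero-case = begin
        (r ∘ (h ⁂ id)) ∘ ⟨ id , z ∘ ! ⟩  ≈⟨ pullʳ ⁂∘⟨⟩ ⟩
        r ∘ ⟨ h ∘ id , id ∘ z ∘ ! ⟩      ≈⟨ ∘-resp-≈ʳ (⟨⟩-cong₂ id-comm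
                                                   (trans identityˡ (sym !-absorbˡ))) ⟩
        r ∘ ⟨ id ∘ h , (z ∘ !) ∘ h ⟩      ≈⟨ ∘-resp-≈ʳ ⟨⟩∘ ⟨
        r ∘ (⟨ id , z ∘ ! ⟩ ∘ h)          ≈⟨ pullˡ r₀ ⟩
        f ∘ h                             ∎
      succ-case : (r ∘ (h ⁂ id)) ∘ (id ⁂ s) ≈ g ∘ (r ∘ (h ⁂ id))
      succ-case = begin
        (r ∘ (h ⁂ id)) ∘ (id ⁂ s)  ≈⟨ pullʳ ⁂-interchange ⟩
        r ∘ ((id ⁂ s) ∘ (h ⁂ id))  ≈⟨ pullˡ r₊ ⟩
        (g ∘ r) ∘ (h ⁂ id)         ≈⟨ assoc ⟩
        g ∘ (r ∘ (h ⁂ id))         ∎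

  rec≈rec-id∘⁂id : ∀ {A X} {f : A ⇒ X} {g : X ⇒ X} → rec f g ≈ rec id g ∘ (f ⁂ id)
  rec≈rec-id∘⁂id {f = f} {g} =
    IsRec-unique (rec-IsRec f g) (trans (proj₁ shifted) identityˡ , proj₂ shifted)
    where shifted = IsRec-∘⁂id f (rec-IsRec id g)

  induction : ∀ {A} {ρ : Sub C (A ×₀ N)} →
              ⟨ id , z ∘ ! ⟩ ∈ₛ ρ → ρ ≤ (id ⁂ s) * ρ → id ∈ₛ ρ
  induction {ρ = ρ} (factor base base-commutes) ρ⊆sρ =
    factor (rec base step) (IsRec-unique (zero-case , succ-case) (identityˡ , id-comm-sym))
    where
      m = Sub.arr ρ
      step-∈ : (id ⁂ s) ∘ m ∈ₛ ρ
      step-∈ = *-∈⁻ (≤⇒∈ {α = ρ} {(id ⁂ s) * ρ} ρ⊆sρ)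
      step = witness step-∈
      zero-case : (m ∘ rec base step) ∘ ⟨ id , z ∘ ! ⟩ ≈ ⟨ id , z ∘ ! ⟩
      zero-case = trans (pullʳ (rec-zero base step)) base-commutes
      succ-case : (m ∘ rec base step) ∘ (id ⁂ s) ≈ (id ⁂ s) ∘ (m ∘ rec base step)
      succ-case = begin
        (m ∘ rec base step) ∘ (id ⁂ s)  ≈⟨ pullʳ (rec-succ base step) ⟩
        m ∘ (step ∘ rec base step)      ≈⟨ pullˡ (commutes step-∈) ⟩
        ((id ⁂ s) ∘ m) ∘ rec base step  ≈⟨ assoc ⟩
        (id ⁂ s) ∘ (m ∘ rec base step)  ∎

  rec-∈ : ∀ {A Y} {f : A ⇒ Y} {g : Y ⇒ Y} {α : Sub C Y} →
          α ≤ g * α → f ∈ₛ α → rec f g ∈ₛ α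
  rec-∈ {f = f} {g} {α} α⊆gα f∈α =
    ∈-resp-≈ identityʳ (*-∈⁻ (induction zero-case succ-case))
    where
      ρ = rec f g * α
      zero-case : ⟨ id , z ∘ ! ⟩ ∈ₛ ρ
      zero-case = *-∈⁺ (∈-resp-≈ (sym (rec-zero f g)) f∈α)
      succ-case : ρ ≤ (id ⁂ s) * ρ
      succ-case = ∈⇒≤ {α = ρ} {(id ⁂ s) * ρ} (*-∈⁺ (*-∈⁺ (∈-resp-≈ moved
        (*-∈⁻ {g = g} {α} (∈-resp-≤ α⊆gα (*-∈⁻ {g = rec f g} {α} arr-∈))))))
        where
          moved : g ∘ (rec f g ∘ Sub.arr ρ) ≈ rec f g ∘ ((id ⁂ s) ∘ Sub.arr ρ)
          moved = trans (sym assoc) (trans (∘-resp-≈ˡ (sym (rec-succ f g))) assoc)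

  -- The recursion builds the pair (n − 1, n), with 0 − 1 = 0.
  pred : ∀ {A} → A ×₀ N ⇒ N
  pred = π₁ ∘ rec ⟨ z ∘ ! , z ∘ ! ⟩ ⟨ π₂ , s ∘ π₂ ⟩

  pred-zero : ∀ {A} → pred {A} ∘ ⟨ id , z ∘ ! ⟩ ≈ z ∘ !
  pred-zero = trans (pullʳ (rec-zero _ _)) project₁

  pred-succ : ∀ {A} → pred {A} ∘ (id ⁂ s) ≈ π₂
  pred-succ = begin
    (π₁ ∘ pairs) ∘ (id ⁂ s)        ≈⟨ pullʳ (rec-succ _ _) ⟩
    π₁ ∘ (⟨ π₂ , s ∘ π₂ ⟩ ∘ pairs)  ≈⟨ pullˡ project₁ ⟩
    π₂ ∘ pairs                     ≈⟨ IsRec-unique π₂∘pairs-IsRec π₂-IsRec ⟩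
    π₂                             ∎
    where
      pairs = rec ⟨ z ∘ ! , z ∘ ! ⟩ ⟨ π₂ , s ∘ π₂ ⟩
      π₂∘pairs-IsRec : IsRec (z ∘ !) s (π₂ ∘ pairs)
      π₂∘pairs-IsRec = trans (pullʳ (rec-zero _ _)) project₂
                     , trans (pullʳ (rec-succ _ _)) (trans (pullˡ project₂) assoc)
      π₂-IsRec : IsRec (z ∘ !) s π₂
      π₂-IsRec = project₂ , project₂

  decrement : ∀ {A} → A ×₀ N ⇒ A ×₀ N
  decrement = ⟨ π₁ , pred ⟩

  π₁∘decrement : ∀ {A} → π₁ ∘ decrement {A} ≈ π₁
  π₁∘decrement = project₁

  decrement-zero : ∀ {A} → decrement {A} ∘ ⟨ id , z ∘ ! ⟩ ≈ ⟨ id , z ∘ ! ⟩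
  decrement-zero = trans ⟨⟩∘ (⟨⟩-cong₂ project₁ pred-zero)

  decrement-succ : ∀ {A} → decrement {A} ∘ (id ⁂ s) ≈ id
  decrement-succ =
    trans ⟨⟩∘ (trans (⟨⟩-cong₂ (trans project₁ identityˡ) pred-succ) ⟨π₁,π₂⟩≈id)

  rec-id-comm : ∀ {X} {g : X ⇒ X} → g ∘ rec id g ≈ rec id g ∘ (g ⁂ id)
  rec-id-comm {g = g} = IsRec-unique (g∘rec-zero , g∘rec-succ)
                                     (trans (proj₁ shifted) identityˡ , proj₂ shifted)
    where
      shifted = IsRec-∘⁂id g (rec-IsRec id g)
      g∘rec-zero : (g ∘ rec id g) ∘ ⟨ id , z ∘ ! ⟩ ≈ g
      g∘rec-zero = trans (pullʳ (rec-zero id g)) identityʳ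
      g∘rec-succ : (g ∘ rec id g) ∘ (id ⁂ s) ≈ g ∘ (g ∘ rec id g)
      g∘rec-succ = pullʳ (rec-succ id g)

  rec-id∘⟨id,π₂⟩ : ∀ {B} {g : B ×₀ N ⇒ B ×₀ N} → g ∘ (id ⁂ s) ≈ id →
                   rec id g ∘ ⟨ id , π₂ ⟩ ≈ ⟨ id , z ∘ ! ⟩ ∘ π₁
  rec-id∘⟨id,π₂⟩ {B} {g} g∘s≈id =
    IsRec-unique (zero-case , succ-case)
                 (trans (pullʳ project₁) identityʳ , trans (pullʳ π₁-succ) (sym identityˡ))
    where
      D = rec id g
      zero-case : (D ∘ ⟨ id , π₂ ⟩) ∘ ⟨ id , z ∘ ! ⟩ ≈ ⟨ id , z ∘ ! ⟩
      zero-case = begin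
        (D ∘ ⟨ id , π₂ ⟩) ∘ ⟨ id , z ∘ ! ⟩  ≈⟨ pullʳ ⟨⟩∘ ⟩
        D ∘ ⟨ id ∘ _ , π₂ ∘ _ ⟩             ≈⟨ ∘-resp-≈ʳ (⟨⟩-cong₂ refl
                                                 (trans project₂ (sym !-absorbˡ))) ⟩
        D ∘ ⟨ id ∘ _ , (z ∘ !) ∘ _ ⟩        ≈⟨ ∘-resp-≈ʳ ⟨⟩∘ ⟨
        D ∘ (⟨ id , z ∘ ! ⟩ ∘ _)            ≈⟨ pullˡ (rec-zero id g) ⟩
        id ∘ ⟨ id , z ∘ ! ⟩                 ≈⟨ identityˡ ⟩
        ⟨ id , z ∘ ! ⟩                      ∎
      succ-case : (D ∘ ⟨ id , π₂ ⟩) ∘ (id ⁂ s) ≈ id ∘ (D ∘ ⟨ id , π₂ ⟩)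
      succ-case = begin
        (D ∘ ⟨ id , π₂ ⟩) ∘ (id ⁂ s)           ≈⟨ pullʳ ⟨⟩∘ ⟩
        D ∘ ⟨ id ∘ (id ⁂ s) , π₂ ∘ (id ⁂ s) ⟩  ≈⟨ ∘-resp-≈ʳ (⟨⟩-cong₂ refl project₂) ⟩
        D ∘ ⟨ id ∘ (id ⁂ s) , s ∘ π₂ ⟩         ≈⟨ ∘-resp-≈ʳ ⁂∘⟨⟩ ⟨
        D ∘ ((id ⁂ s) ∘ ⟨ id ⁂ s , π₂ ⟩)       ≈⟨ pullˡ (rec-succ id g) ⟩
        (g ∘ D) ∘ ⟨ id ⁂ s , π₂ ⟩              ≈⟨ ∘-resp-≈ˡ rec-id-comm ⟩
        (D ∘ (g ⁂ id)) ∘ ⟨ id ⁂ s , π₂ ⟩       ≈⟨ pullʳ ⁂∘⟨⟩ ⟩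
        D ∘ ⟨ g ∘ (id ⁂ s) , id ∘ π₂ ⟩         ≈⟨ ∘-resp-≈ʳ (⟨⟩-cong₂ g∘s≈id identityˡ) ⟩
        D ∘ ⟨ id , π₂ ⟩                        ≈⟨ identityˡ ⟨
        id ∘ (D ∘ ⟨ id , π₂ ⟩)                 ∎
      π₁-succ : π₁ ∘ (id ⁂ s) ≈ π₁ {B} {N}
      π₁-succ = trans project₁ identityˡ

  countdown : ∀ {A B} {f : A ⇒ B ×₀ N} {g : B ×₀ N ⇒ B ×₀ N} → g ∘ (id ⁂ s) ≈ id →
              rec f g ∘ ⟨ id , π₂ ∘ f ⟩ ≈ ⟨ id , z ∘ ! ⟩ ∘ (π₁ ∘ f)
  countdown {f = f} {g} g∘s≈id = begin
    rec f g ∘ ⟨ id , π₂ ∘ f ⟩                ≈⟨ ∘-resp-≈ˡ rec≈rec-id∘⁂id ⟩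
    (rec id g ∘ (f ⁂ id)) ∘ ⟨ id , π₂ ∘ f ⟩  ≈⟨ pullʳ ⁂∘⟨⟩ ⟩
    rec id g ∘ ⟨ f ∘ id , id ∘ π₂ ∘ f ⟩      ≈⟨ ∘-resp-≈ʳ (⟨⟩-cong₂ id-comm identityˡ) ⟩
    rec id g ∘ ⟨ id ∘ f , π₂ ∘ f ⟩           ≈⟨ ∘-resp-≈ʳ ⟨⟩∘ ⟨
    rec id g ∘ (⟨ id , π₂ ⟩ ∘ f)             ≈⟨ pullˡ (rec-id∘⟨id,π₂⟩ g∘s≈id) ⟩
    (⟨ id , z ∘ ! ⟩ ∘ π₁) ∘ f                ≈⟨ assoc ⟩
    ⟨ id , z ∘ ! ⟩ ∘ (π₁ ∘ f)                ∎

module CoherentNaturalNumbers {o ℓ e} {C : Category o ℓ e} (K : Coherent C)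
                              (NNO : PNO (Coherent.finitelyComplete K)) where
  open Category C
  open Coherent K
  open PNO NNO
  open HomReasoning C
  open ProductLaws finitelyComplete
  open Membership finitelyComplete
  open Unions K
  open NaturalNumbers NNO

  zero-or-succ : ∀ {A} → id ∈ₛ image ⟨ id {A} , z ∘ ! ⟩ ∨ image (id ⁂ s)
  zero-or-succ {A} = induction (∈-resp-≤ (∨-inl (image a) (image b)) (∈-image a))
                               (∈⇒≤ {α = E} {b * E} (*-∈⁺ {α = E} b∘E∈E))
    where
      a : A ⇒ A ×₀ N
      a = ⟨ id , z ∘ ! ⟩
      b : A ×₀ N ⇒ A ×₀ N
      b = id ⁂ s
      E = image a ∨ image b
      b∘E∈E : b ∘ Sub.arr E ∈ₛ E
      b∘E∈E = ∈-resp-≤ (∨-inr (image a) (image b)) (∈-∘ (∈-image b) (Sub.arr E))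

  decrement-closed : ∀ {X} {φ : Sub C X} {ψ : Sub C (X ×₀ N)} →
                     (id ⁂ s) * ψ ≤ π₁ * φ ∨ ψ →
                     π₁ * φ ∨ ψ ≤ decrement * (π₁ * φ ∨ ψ)
  decrement-closed {φ = φ} {ψ} step = ∨-least (π₁ * φ) ψ (decrement * U) φ-part ψ-part
    where
      U = π₁ * φ ∨ ψ
      m = Sub.arr ψ
      ψ⊆U : ψ ≤ U
      ψ⊆U = ∨-inr (π₁ * φ) ψ

      φ-part : π₁ * φ ≤ decrement * U
      φ-part = ∈⇒≤ {α = π₁ * φ} {decrement * U}
        (*-∈⁺ {α = U} (∈-resp-≤ (∨-inl (π₁ * φ) ψ) (*-∈⁺ {α = φ} π₁∘decrement∘arr∈φ)))
        where
          π₁∘decrement∘arr∈φ : π₁ ∘ (decrement ∘ Sub.arr (π₁ * φ)) ∈ₛ φ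
          π₁∘decrement∘arr∈φ =
            ∈-resp-≈ (sym (pullˡ π₁∘decrement)) (*-∈⁻ {g = π₁} {φ} arr-∈)

      zero-part : m * image ⟨ id , z ∘ ! ⟩ ≤ m * (decrement * U)
      zero-part =
        *-image-≤ (*-∈⁺ {α = U} (∈-resp-≈ fixed (∈-resp-≤ ψ⊆U (∈-∘ (arr-∈ {α = ψ}) p₁))))
        where
          pb = pullback m ⟨ id , z ∘ ! ⟩
          p₁ = Pullback.p₁ pb
          p₂ = Pullback.p₂ pb
          fixed : m ∘ p₁ ≈ decrement ∘ (m ∘ p₁)
          fixed = begin
            m ∘ p₁                            ≈⟨ Pullback.commute pb ⟩
            ⟨ id , z ∘ ! ⟩ ∘ p₂                ≈⟨ pullˡ decrement-zero ⟨
            decrement ∘ (⟨ id , z ∘ ! ⟩ ∘ p₂)  ≈⟨ ∘-resp-≈ʳ (Pullback.commute pb) ⟨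
            decrement ∘ (m ∘ p₁)              ∎

      succ-part : m * image (id ⁂ s) ≤ m * (decrement * U)
      succ-part = *-image-≤ (*-∈⁺ {α = U} (∈-resp-≈ predecessor (∈-resp-≤ step p₂∈sψ)))
        where
          pb = pullback m (id ⁂ s)
          p₁ = Pullback.p₁ pb
          p₂ = Pullback.p₂ pb
          p₂∈sψ : p₂ ∈ₛ (id ⁂ s) * ψ
          p₂∈sψ = *-∈⁺ {α = ψ} (∈-resp-≈ (Pullback.commute pb) (∈-∘ arr-∈ p₁))
          predecessor : p₂ ≈ decrement ∘ (m ∘ p₁)
          predecessor = begin
            p₂                            ≈⟨ identityˡ ⟨
            id ∘ p₂                       ≈⟨ pullˡ decrement-succ ⟨
            decrement ∘ ((id ⁂ s) ∘ p₂)   ≈⟨ ∘-resp-≈ʳ (Pullback.commute pb) ⟨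
            decrement ∘ (m ∘ p₁)          ∎

      ψ-part : ψ ≤ decrement * U
      ψ-part = ∈⇒≤ {α = ψ} {decrement * U}
        (∈-∨-elim (∈-resp-≈ identityˡ (∈-∘ zero-or-succ m)) zero-part succ-part)

lemma2p4 : ∀ {o ℓ e} (C : Category o ℓ e) (K : Coherent C)
           (NNO : PNO (Coherent.finitelyComplete K))
           (X : Category.Obj C) (φ : Sub C X)
           (ψ : Sub C (Coherent._×₀_ K X (PNO.N NNO))) →
           let open Category C
               open Coherent K
               open PNO NNO
           in _≤ₛ_ C (⟨ id , z ∘ ! ⟩ * ψ) φ →
              _≤ₛ_ C ((id ⁂ s) * ψ) (π₁ * φ ∨ ψ) →
              _≤ₛ_ C ψ (π₁ * φ)
lemma2p4 C K NNO X φ ψ base step =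
  ∈⇒≤ {α = ψ} {π₁ * φ} (*-∈⁺ {α = φ} (∈-resp-≤ zero-fibre-≤φ (*-∈⁺ {α = U} reaches-zero)))
  where
    open Category C
    open Coherent K
    open PNO NNO
    open ProductLaws finitelyComplete
    open Membership finitelyComplete
    open Unions K
    open NaturalNumbers NNO
    open CoherentNaturalNumbers K NNO

    U = π₁ * φ ∨ ψ
    m = Sub.arr ψ

    zero-fibre-≤φ : ⟨ id , z ∘ ! ⟩ * U ≤ φ
    zero-fibre-≤φ =
      *-∨-least ⟨ id , z ∘ ! ⟩ {π₁ * φ} {ψ} {φ} (*-section-≤ {α = φ} project₁) base

    iterates-in-U : rec m decrement ∈ₛ U
    iterates-in-U = rec-∈ {α = U} (decrement-closed {φ = φ} {ψ} step)
                                  (∈-resp-≤ (∨-inr (π₁ * φ) ψ) (arr-∈ {α = ψ}))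

    reaches-zero : ⟨ id , z ∘ ! ⟩ ∘ (π₁ ∘ m) ∈ₛ U
    reaches-zero = ∈-resp-≈ (countdown decrement-succ) (∈-∘ iterates-in-U ⟨ id , π₂ ∘ m ⟩)
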